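{- For every complete $k$-partite graph $K_{r_1,\ldots,r_k}$ with $k\ge 3$ and $r_j=3$ for some $j\in\{1,\ldots,k\}$ we have $\chi_g(K_{r_1,\ldots,r_k})\le 2k-2$.
   Context: Graph coloring game: given a graph $G$ and a finite set $C$ of colors, Alice and Bob alternately (Alice first) pick an uncolored vertex and give it a legal color, i.e. a color from $C$ not used on any neighbor. The game ends when all vertices are colored (Alice wins) or when no uncolored vertex has a legal color (Bob wins). The game chromatic number $\chi_g(G)$ is the minimum $|C|$ for which Alice has a winning strategy. $K_{r_1,\ldots,r_k}$ denotes the complete $k$-partite graph with parts (independent sets) $V_1,\ldots,V_k$, $|V_i|=r_i\ge1$, $r_1\ge\cdots\ge r_k$, every two vertices in different parts adjacent; the paper assumes that if $k\ge2$ then $r_1\ge 2$. -}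

module Defs where

open import Data.Nat using (ℕ; zero; suc; _≤_; _≥_; _∸_; _*_)
open import Data.Fin using (Fin; toℕ)
open import Data.Maybe using (Maybe; just; nothing)
open import Data.Product using (Σ; ∃; _×_; _,_; proj₁; ∃-syntax)
open import Relation.Binary.PropositionalEquality using (_≡_; _≢_)
open import Relation.Nullary using (¬_)

module Game (V : Set) (Adj : V → V → Set) (m : ℕ) where

  Position : Set
  Position = V → Maybe (Fin m)

  AllColored : Position → Set
  AllColored s = ∀ v → ∃[ c ] (s v ≡ just c)

  Legal : Position → V → Fin m → Set
  Legal s v c = (s v ≡ nothing) × (∀ w → Adj v w → s w ≢ just c)

  Step : Position → V → Fin m → Position → Set
  Step s v c s' = (s' v ≡ just c) × (∀ w → w ≢ v → s' w ≡ s w)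

  HasMove : Position → Set
  HasMove s = ∃[ v ] ∃[ c ] Legal s v c

  -- AliceWinsA s : Alice (to move) has a winning strategy from s.
  -- AliceWinsB s : Bob is to move from s and Alice has a winning strategy.
  -- The game is finite, so the inductive (well-founded) definition
  -- captures exactly the existence of a winning strategy for Alice.
  data AliceWinsA (s : Position) : Set
  data AliceWinsB (s : Position) : Set

  data AliceWinsA s where
    doneA : AllColored s → AliceWinsA s
    moveA : (v : V) (c : Fin m) (s' : Position) →
            Legal s v c → Step s v c s' → AliceWinsB s' → AliceWinsA s

  data AliceWinsB s where
    doneB : AllColored s → AliceWinsB s
    moveB : HasMove s →
            (∀ v c s' → Legal s v c → Step s v c s' → AliceWinsA s') →
            AliceWinsB s

  empty : Position
  empty _ = nothing

  AliceWins : Set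
  AliceWins = AliceWinsA empty

-- χ_g(G) ≤ n : the minimum number of colors for which Alice wins is ≤ n,
-- i.e. Alice wins with some m ≤ n colors.
GameChromatic≤ : (V : Set) → (V → V → Set) → ℕ → Set
GameChromatic≤ V Adj n = ∃[ m ] (m ≤ n × Game.AliceWins V Adj m)

KVertex : (k : ℕ) → (Fin k → ℕ) → Set
KVertex k r = Σ (Fin k) (λ i → Fin (r i))

KAdj : (k : ℕ) (r : Fin k → ℕ) → KVertex k r → KVertex k r → Set
KAdj k r v w = proj₁ v ≢ proj₁ w

-- the paper's standing assumptions on the part sizes:
-- r_i ≥ 1, r_1 ≥ ... ≥ r_k, and r_1 ≥ 2 when k ≥ 2.
ValidParts : (k : ℕ) → (Fin k → ℕ) → Set
ValidParts k r =
  (∀ i → 1 ≤ r i) ×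
  (∀ i j → toℕ i ≤ toℕ j → r j ≤ r i) ×
  (k ≥ 2 → ∀ (i : Fin k) → toℕ i ≡ 0 → 2 ≤ r i)

-- Let u be the number of colors in use and f the number of parts with no colored vertex.
-- Alice starts an untouched part with a new color whenever one exists, and otherwise
-- colors inside a touched part with a color already in that part, which is legal because in a
-- complete multipartite graph a color used in one part occurs in no other. Her moves lower
-- u + 2f by one, Bob's raise it by at most one, so keeping u + 2f ≤ m + 1 before her moves
-- (m = 2k − 2 colors) guarantees a new color whenever an untouched part remains, and keeps
-- Bob from getting stuck. Initially u + 2f = 2k = m + 2, one too many; the part of size 3
-- pays for it. Alice opens there with color c₀. If Bob answers outside that part or with c₀,
-- the invariant holds. If he answers inside it with a new color, Alice colors its last
-- vertex with c₀, and Bob is forced into an untouched part, which restores the invariant.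

module Submission where

open import Defs
open import Data.Nat using (ℕ; zero; suc; _+_; _*_; _∸_; _≤_; _<_; _≥_; z≤n; s≤s)
open import Data.Nat.Properties
  using ( +-0-commutativeMonoid; ≤-refl; ≤-trans; ≤-reflexive; ≤-pred; n≤1+n; m≤m+n; m≤n+m
        ; +-mono-≤; +-monoˡ-≤; +-monoʳ-≤; *-monoʳ-≤; +-identityʳ; +-cancelʳ-≡; +-cancelʳ-≤
        ; +-suc; +-comm; suc-injective; n≤0⇒n≡0; module ≤-Reasoning )
open import Data.Nat.Tactic.RingSolver using (solve-∀)
open import Data.Fin using (Fin; zero; suc; punchIn; fromℕ<; _≟_)
open import Data.Fin.Properties using (punchInᵢ≢i; any?; all?; ¬∀⟶∃¬)
open import Data.Maybe using (just; nothing)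
open import Data.Maybe.Properties using (just-injective) renaming (≡-dec to ≡-dec-Maybe)
open import Data.Product using (∃; ∃-syntax; _×_; _,_; proj₁; proj₂)
open import Data.Product.Properties using () renaming (≡-dec to ≡-dec-Σ)
open import Data.Sum using (_⊎_; inj₁; inj₂)
open import Data.Empty using (⊥; ⊥-elim)
open import Function using (_∘_; _⇔_; mk⇔; Equivalence; case_of_)
open import Level using (Level)
open import Relation.Binary.Definitions using (DecidableEquality)
open import Relation.Binary.PropositionalEquality
  using (_≡_; _≢_; refl; sym; trans; cong; cong₂; subst; module ≡-Reasoning)
open import Relation.Nullary using (Dec; yes; no; ¬_)
open import Relation.Nullary.Decidable using (map′)
open import Relation.Unary using (Pred; Decidable)

open import Algebra.Properties.CommutativeMonoid.Sum +-0-commutativeMonoid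
  using (sum; sum-remove; sum-cong-≗)

private variable
  ℓ : Level
  n : ℕ

sum-agree-except : {f g : Fin n → ℕ} (y : Fin n) → (∀ x → x ≢ y → f x ≡ g x) →
                   sum f + g y ≡ sum g + f y
sum-agree-except {suc n} {f} {g} y f≡g = begin
  sum f + g y                   ≡⟨ cong (_+ g y) (sum-remove f) ⟩
  f y + sum (f ∘ punchIn y) + g y ≡⟨ cong (λ t → f y + t + g y)
                                      (sum-cong-≗ λ x → f≡g _ (punchInᵢ≢i y x)) ⟩
  f y + sum (g ∘ punchIn y) + g y ≡⟨ swap (f y) (g y) _ ⟩
  g y + sum (g ∘ punchIn y) + f y ≡⟨ cong (_+ f y) (sym (sum-remove g)) ⟩
  sum g + f y                   ∎
  where
  open ≡-Reasoning
  swap : ∀ a b t → a + t + b ≡ b + t + a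
  swap = solve-∀

sum-suc-except : {f g : Fin n → ℕ} (y : Fin n) → (∀ x → x ≢ y → f x ≡ g x) →
             f y ≡ suc (g y) → sum f ≡ suc (sum g)
sum-suc-except {f = f} {g} y f≡g fy≡1+gy = +-cancelʳ-≡ (g y) (sum f) (suc (sum g)) (begin
  sum f + g y         ≡⟨ sum-agree-except y f≡g ⟩
  sum g + f y         ≡⟨ cong (sum g +_) fy≡1+gy ⟩
  sum g + suc (g y)   ≡⟨ +-suc (sum g) (g y) ⟩
  suc (sum g) + g y   ∎)
  where open ≡-Reasoning

indicator : {A : Set ℓ} → Dec A → ℕ
indicator (yes _) = 1
indicator (no _)  = 0

module _ {A : Set ℓ} where

  indicator-yes : A → (a? : Dec A) → indicator a? ≡ 1
  indicator-yes _ (yes _) = refl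
  indicator-yes a (no ¬a) = ⊥-elim (¬a a)

  indicator-no : ¬ A → (a? : Dec A) → indicator a? ≡ 0
  indicator-no ¬a (yes a) = ⊥-elim (¬a a)
  indicator-no _  (no _)  = refl

  indicator≤1 : (a? : Dec A) → indicator a? ≤ 1
  indicator≤1 (yes _) = ≤-refl
  indicator≤1 (no _)  = z≤n

indicator-mono : {A B : Set ℓ} → (A → B) → (a? : Dec A) (b? : Dec B) → indicator a? ≤ indicator b?
indicator-mono A⇒B (yes a) b? = ≤-reflexive (sym (indicator-yes (A⇒B a) b?))
indicator-mono A⇒B (no _)  b? = z≤n

indicator-cong : {A B : Set ℓ} → A ⇔ B → (a? : Dec A) (b? : Dec B) → indicator a? ≡ indicator b?
indicator-cong A⇔B (yes a) b? = sym (indicator-yes (Equivalence.to A⇔B a) b?)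
indicator-cong A⇔B (no ¬a) b? = sym (indicator-no (¬a ∘ Equivalence.from A⇔B) b?)

count : {P : Pred (Fin n) ℓ} → Decidable P → ℕ
count P? = sum (indicator ∘ P?)

count≤n : {P : Pred (Fin n) ℓ} (P? : Decidable P) → count P? ≤ n
count≤n {zero}  P? = z≤n
count≤n {suc n} P? = +-mono-≤ (indicator≤1 (P? zero)) (count≤n (P? ∘ suc))

count-none : {P : Pred (Fin n) ℓ} (P? : Decidable P) → (∀ x → ¬ P x) → count P? ≡ 0
count-none {zero}  P? ¬P = refl
count-none {suc n} P? ¬P =
  cong₂ _+_ (indicator-no (¬P zero) (P? zero)) (count-none (P? ∘ suc) (¬P ∘ suc))

count-all : {P : Pred (Fin n) ℓ} (P? : Decidable P) → (∀ x → P x) → count P? ≡ n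
count-all {zero}  P? p = refl
count-all {suc n} P? p = cong₂ _+_ (indicator-yes (p zero) (P? zero)) (count-all (P? ∘ suc) (p ∘ suc))

count>0⇒∃ : {P : Pred (Fin n) ℓ} (P? : Decidable P) → 0 < count P? → ∃ P
count>0⇒∃ {suc n} P? pos with P? zero
... | yes p = zero , p
... | no _  = let x , p = count>0⇒∃ (P? ∘ suc) pos in suc x , p

∃⇒count>0 : {P : Pred (Fin n) ℓ} (P? : Decidable P) → ∀ {x} → P x → 0 < count P?
∃⇒count>0 {suc n} P? {zero}  p = ≤-trans (≤-reflexive (sym (indicator-yes p (P? zero)))) (m≤m+n _ _)
∃⇒count>0 {suc n} P? {suc x} p = ≤-trans (∃⇒count>0 (P? ∘ suc) p) (m≤n+m _ _)

count<n⇒∃¬ : {P : Pred (Fin n) ℓ} (P? : Decidable P) → count P? < n → ∃ (¬_ ∘ P)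
count<n⇒∃¬ {suc n} P? lt with P? zero
... | no ¬p = zero , ¬p
... | yes _ = let x , ¬p = count<n⇒∃¬ (P? ∘ suc) (≤-pred lt) in suc x , ¬p

module _ {P Q : Pred (Fin n) ℓ} (P? : Decidable P) (Q? : Decidable Q) where

  count-cong : (∀ x → P x ⇔ Q x) → count P? ≡ count Q?
  count-cong P⇔Q = sum-cong-≗ λ x → indicator-cong (P⇔Q x) (P? x) (Q? x)

  module _ {y : Fin n} (P⇔Q : ∀ x → x ≢ y → P x ⇔ Q x) where

    private
      indicators-agree : ∀ x → x ≢ y → indicator (P? x) ≡ indicator (Q? x)
      indicators-agree x x≢y = indicator-cong (P⇔Q x x≢y) (P? x) (Q? x)

      agree : count P? + indicator (Q? y) ≡ count Q? + indicator (P? y)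
      agree = sum-agree-except y indicators-agree

    count-suc-except : P y → ¬ Q y → count P? ≡ suc (count Q?)
    count-suc-except p ¬q = sum-suc-except y indicators-agree
      (trans (indicator-yes p (P? y)) (cong suc (sym (indicator-no ¬q (Q? y)))))

    count-≤-suc-except : count Q? ≤ suc (count P?)
    count-≤-suc-except = begin
      count Q?                       ≤⟨ m≤m+n _ _ ⟩
      count Q? + indicator (P? y)    ≡⟨ sym agree ⟩
      count P? + indicator (Q? y)    ≤⟨ +-monoʳ-≤ (count P?) (indicator≤1 (Q? y)) ⟩
      count P? + 1                   ≡⟨ +-comm (count P?) 1 ⟩
      suc (count P?)                 ∎
      where open ≤-Reasoning

    count-≤-except : (Q y → P y) → count Q? ≤ count P?
    count-≤-except Q⇒P = +-cancelʳ-≤ (indicator (P? y)) (count Q?) (count P?) (begin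
      count Q? + indicator (P? y)    ≡⟨ sym agree ⟩
      count P? + indicator (Q? y)    ≤⟨ +-monoʳ-≤ (count P?) (indicator-mono Q⇒P (Q? y) (P? y)) ⟩
      count P? + indicator (P? y)    ∎)
      where open ≤-Reasoning

bound-after-fresh-move : ∀ {u u' f f' m} →
  u' ≤ suc u → suc f' ≤ f → u + 2 * f ≤ suc m → u' + 2 * f' ≤ m
bound-after-fresh-move {u} {u'} {f} {f'} {m} u'≤ f'<f Φ = ≤-pred (begin
  suc (u' + 2 * f')      ≤⟨ s≤s (+-monoˡ-≤ (2 * f') u'≤) ⟩
  suc (suc u + 2 * f')   ≡⟨ shift u f' ⟩
  u + 2 * suc f'         ≤⟨ +-monoʳ-≤ u (*-monoʳ-≤ 2 f'<f) ⟩
  u + 2 * f              ≤⟨ Φ ⟩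
  suc m                  ∎)
  where
  open ≤-Reasoning
  shift : ∀ u f → suc (suc u + 2 * f) ≡ u + 2 * suc f
  shift = solve-∀

bound-after-move : ∀ {u u' f f' m} → u' ≤ suc u → f' ≤ f → u + 2 * f ≤ m → u' + 2 * f' ≤ suc m
bound-after-move u'≤ f'≤f Φ = ≤-trans (+-mono-≤ u'≤ (*-monoʳ-≤ 2 f'≤f)) (s≤s Φ)

room-for-new-color : ∀ {u f m} → 1 ≤ f → u + 2 * f ≤ suc m → u < m
room-for-new-color {u} {f} {m} 1≤f Φ = ≤-pred (begin
  suc (suc u)   ≡⟨ +-comm 2 u ⟩
  u + 2 * 1     ≤⟨ +-monoʳ-≤ u (*-monoʳ-≤ 2 1≤f) ⟩
  u + 2 * f     ≤⟨ Φ ⟩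
  suc m         ∎)
  where open ≤-Reasoning

module KGame (k : ℕ) (r : Fin k → ℕ) (m : ℕ) where

  open Game (KVertex k r) (KAdj k r) m public

  private
    V : Set
    V = KVertex k r

  _≟ᵥ_ : DecidableEquality V
  _≟ᵥ_ = ≡-dec-Σ _≟_ _≟_

  color : Position → V → Fin m → Position
  color s v c w with w ≟ᵥ v
  ... | yes _ = just c
  ... | no  _ = s w

  color-step : ∀ s v c → Step s v c (color s v c)
  color-step s v c = colored , unchanged
    where
    colored : color s v c v ≡ just c
    colored with v ≟ᵥ v
    ... | yes _   = refl
    ... | no v≢v = ⊥-elim (v≢v refl)
    unchanged : ∀ w → w ≢ v → color s v c w ≡ s w
    unchanged w w≢v with w ≟ᵥ v
    ... | yes w≡v = ⊥-elim (w≢v w≡v)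
    ... | no  _   = refl

  Uncolored : Position → V → Set
  Uncolored s v = s v ≡ nothing

  uncolored? : ∀ s → Decidable (Uncolored s)
  uncolored? s v = ≡-dec-Maybe _≟_ (s v) nothing

  Used : Position → Fin m → Set
  Used s c = ∃[ v ] s v ≡ just c

  used? : ∀ s → Decidable (Used s)
  used? s c = map′ (λ (i , a , e) → (i , a) , e) (λ ((i , a) , e) → i , a , e)
                   (any? λ i → any? λ a → ≡-dec-Maybe _≟_ (s (i , a)) (just c))

  Fresh : Position → Fin k → Set
  Fresh s i = ∀ a → Uncolored s (i , a)

  fresh? : ∀ s → Decidable (Fresh s)
  fresh? s i = all? λ a → uncolored? s (i , a)

  Proper : Position → Set
  Proper s = ∀ v w c → KAdj k r v w → s v ≡ just c → s w ≡ just c → ⊥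

  colored≢uncolored : ∀ {s v w c} → s v ≡ just c → Uncolored s w → v ≢ w
  colored≢uncolored colored uncolored refl with () ← trans (sym colored) uncolored

  #used : Position → ℕ
  #used s = count (used? s)

  #fresh : Position → ℕ
  #fresh s = count (fresh? s)

  #uncoloredIn : Position → Fin k → ℕ
  #uncoloredIn s i = count λ a → uncolored? s (i , a)

  #uncolored : Position → ℕ
  #uncolored s = sum (#uncoloredIn s)

  potential : Position → ℕ
  potential s = #used s + 2 * #fresh s

  module _ {s s' : Position} {i : Fin k} {a : Fin (r i)} {c : Fin m}
           (L : Legal s (i , a) c) (St : Step s (i , a) c s') where

    private
      unchanged : ∀ w → w ≢ (i , a) → s' w ≡ s w
      unchanged = proj₂ St

      earlier : ∀ {w d} → w ≢ (i , a) → s' w ≡ just d → s w ≡ just d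
      earlier w≢v = trans (sym (unchanged _ w≢v))

      uncolored-agree : ∀ w → w ≢ (i , a) → Uncolored s w ⇔ Uncolored s' w
      uncolored-agree w w≢v = mk⇔ (trans (unchanged w w≢v)) (trans (sym (unchanged w w≢v)))

      used-agree : ∀ c' → c' ≢ c → Used s c' ⇔ Used s' c'
      used-agree c' c'≢c = mk⇔ to from
        where
        to : Used s c' → Used s' c'
        to (w , e) = w , trans (unchanged w (colored≢uncolored e (proj₁ L))) e
        from : Used s' c' → Used s c'
        from (w , e) with w ≟ᵥ (i , a)
        ... | yes refl = ⊥-elim (c'≢c (just-injective (trans (sym e) (proj₁ St))))
        ... | no w≢v   = w , earlier w≢v e

      fresh-agree : ∀ j → j ≢ i → Fresh s j ⇔ Fresh s' j
      fresh-agree j j≢i = mk⇔ (λ F b → Equivalence.to (uncolored-agree _ (j≢i ∘ cong proj₁)) (F b))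
                              (λ F b → Equivalence.from (uncolored-agree _ (j≢i ∘ cong proj₁)) (F b))

      not-fresh : ¬ Fresh s' i
      not-fresh F with () ← trans (sym (proj₁ St)) (F a)

    proper-step : Proper s → Proper s'
    proper-step P x y d x~y ex ey with x ≟ᵥ (i , a) | y ≟ᵥ (i , a)
    ... | yes refl | yes refl = x~y refl
    ... | yes refl | no y≢v   = proj₂ L y x~y (earlier y≢v (trans ey (trans (sym ex) (proj₁ St))))
    ... | no x≢v   | yes refl = proj₂ L x (x~y ∘ sym) (earlier x≢v (trans ex (trans (sym ey) (proj₁ St))))
    ... | no x≢v   | no y≢v   = P x y d x~y (earlier x≢v ex) (earlier y≢v ey)

    #used-step : #used s' ≤ suc (#used s)
    #used-step = count-≤-suc-except (used? s) (used? s') used-agree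

    #used-step-reused : Used s c → #used s' ≤ #used s
    #used-step-reused u = count-≤-except (used? s) (used? s') used-agree (λ _ → u)

    #fresh-step : #fresh s' ≤ #fresh s
    #fresh-step = count-≤-except (fresh? s) (fresh? s') fresh-agree (⊥-elim ∘ not-fresh)

    #fresh-step-fresh : Fresh s i → #fresh s' < #fresh s
    #fresh-step-fresh F = ≤-reflexive (sym (count-suc-except (fresh? s) (fresh? s') fresh-agree F not-fresh))

    #uncoloredIn-step : #uncoloredIn s i ≡ suc (#uncoloredIn s' i)
    #uncoloredIn-step = count-suc-except _ _
      (λ b b≢a → uncolored-agree (i , b) λ { refl → b≢a refl })
      (proj₁ L) (λ e → colored≢uncolored {s = s'} (proj₁ St) e refl)

    #uncolored-step : #uncolored s' < #uncolored s
    #uncolored-step = ≤-reflexive (sym (sum-suc-except i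
      (λ j j≢i → count-cong _ _ λ b → uncolored-agree (j , b) (j≢i ∘ cong proj₁))
      #uncoloredIn-step))

  legal-unused : ∀ {s v c} → Uncolored s v → ¬ Used s c → Legal s v c
  legal-unused unc unused = unc , λ w _ e → unused (w , e)

  legal-part-color : ∀ {s i a} → Proper s → Uncolored s (i , a) → ¬ Fresh s i →
                     ∃[ c ] Legal s (i , a) c
  legal-part-color {s} {i} P unc ¬fresh with ¬∀⟶∃¬ _ _ (λ a → uncolored? s (i , a)) ¬fresh
  ... | a' , colored with s (i , a') in e
  ... | just c  = c , unc , λ w i≢w e' → P (i , a') w c i≢w e e'
  ... | nothing = ⊥-elim (colored refl)

  hasMove : ∀ {s i a} → Proper s → Uncolored s (i , a) → (Fresh s i → #used s < m) → HasMove s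
  hasMove {s} {i} {a} P unc room with fresh? s i
  ... | no ¬fresh = let c , L = legal-part-color P unc ¬fresh in (i , a) , c , L
  ... | yes fresh = let c , unused = count<n⇒∃¬ (used? s) (room fresh)
                    in (i , a) , c , legal-unused unc unused

  allColored-or-uncolored : ∀ s → AllColored s ⊎ ∃ (Uncolored s)
  allColored-or-uncolored s with any? (λ i → any? (λ a → uncolored? s (i , a)))
  ... | yes (i , a , unc) = inj₂ ((i , a) , unc)
  ... | no none = inj₁ colored
    where
    colored : AllColored s
    colored (i , a) with s (i , a) in e
    ... | just c  = c , refl
    ... | nothing = ⊥-elim (none (i , a , e))

  potential-without-fresh : ∀ {s} → #fresh s ≡ 0 → potential s ≤ m
  potential-without-fresh {s} f≡0 = begin
    #used s + 2 * #fresh s   ≡⟨ cong (λ f → #used s + 2 * f) f≡0 ⟩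
    #used s + 0              ≡⟨ +-identityʳ (#used s) ⟩
    #used s                  ≤⟨ count≤n (used? s) ⟩
    m                        ∎
    where open ≤-Reasoning

  module Strategy (pos : ∀ i → 1 ≤ r i) where

    aliceMove : ∀ {s i a} → Proper s → Uncolored s (i , a) → potential s ≤ suc m →
                ∃[ v ] ∃[ c ] Legal s v c × potential (color s v c) ≤ m
    aliceMove {s} {i} {a} P unc Φ with any? (fresh? s)
    ... | yes (i' , fresh) =
      let c , unused = count<n⇒∃¬ (used? s) (room-for-new-color (∃⇒count>0 (fresh? s) fresh) Φ)
          L  = legal-unused (fresh (fromℕ< (pos i'))) unused
          St = color-step s _ c
      in _ , c , L , bound-after-fresh-move (#used-step L St) (#fresh-step-fresh L St fresh) Φ
    ... | no ¬fresh =
      let c , L = legal-part-color P unc (λ fresh → ¬fresh (i , fresh))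
          St = color-step s _ c
          none-fresh = count-none (fresh? s) λ i' fresh → ¬fresh (i' , fresh)
          no-fresh-left = n≤0⇒n≡0 (≤-trans (#fresh-step L St) (≤-reflexive none-fresh))
      in _ , c , L , potential-without-fresh no-fresh-left

    aliceWinsA-fuel : ∀ n s → #uncolored s < n → Proper s → potential s ≤ suc m → AliceWinsA s
    aliceWinsB-fuel : ∀ n s → #uncolored s < n → Proper s → potential s ≤ m → AliceWinsB s

    aliceWinsA-fuel zero s ()
    aliceWinsA-fuel (suc n) s fuel P Φ with allColored-or-uncolored s
    ... | inj₁ done = doneA done
    ... | inj₂ (_ , unc) =
      let v , c , L , Φ' = aliceMove P unc Φ
          St = color-step s v c
      in moveA v c _ L St
           (aliceWinsB-fuel n _ (≤-trans (#uncolored-step L St) (≤-pred fuel)) (proper-step L St P) Φ')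

    aliceWinsB-fuel zero s ()
    aliceWinsB-fuel (suc n) s fuel P Φ with allColored-or-uncolored s
    ... | inj₁ done = doneB done
    ... | inj₂ ((i , a) , unc) = moveB (hasMove P unc room) respond
      where
      room : Fresh s i → #used s < m
      room fresh = room-for-new-color (∃⇒count>0 (fresh? s) fresh) (≤-trans Φ (n≤1+n m))
      respond : ∀ v c s' → Legal s v c → Step s v c s' → AliceWinsA s'
      respond _ _ s' L St =
        aliceWinsA-fuel n s' (≤-trans (#uncolored-step L St) (≤-pred fuel)) (proper-step L St P)
          (bound-after-move (#used-step L St) (#fresh-step L St) Φ)

    aliceWinsA-bounded : ∀ {s u f} → Proper s → #used s ≤ u → #fresh s ≤ f → u + 2 * f ≤ suc m →
                         AliceWinsA s
    aliceWinsA-bounded {s} P u-bound f-bound Φ = aliceWinsA-fuel (suc (#uncolored s)) s ≤-refl P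
      (≤-trans (+-mono-≤ u-bound (*-monoʳ-≤ 2 f-bound)) Φ)

module Opening (K : ℕ) (r : Fin (3 + K) → ℕ) (pos : ∀ i → 1 ≤ r i)
               (j : Fin (3 + K)) (rj≡3 : r j ≡ 3) where

  open KGame (3 + K) r (4 + 2 * K)
  open Strategy pos

  Untouched : Position → Set
  Untouched s = ∀ w → proj₁ w ≢ j → Uncolored s w

  untouched-empty : Untouched empty
  untouched-empty _ _ = refl

  untouched-step : ∀ {s s' v c} → Untouched s → Step s v c s' → proj₁ v ≡ j → Untouched s'
  untouched-step T St v∈j w w∉j =
    trans (proj₂ St w λ w≡v → w∉j (trans (cong proj₁ w≡v) v∈j)) (T w w∉j)

  untouched-fresh : ∀ {s i} → Untouched s → i ≢ j → Fresh s i
  untouched-fresh T i≢j a = T (_ , a) i≢j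

  untouched-legal : ∀ {s a c} → Untouched s → Uncolored s (j , a) → Legal s (j , a) c
  untouched-legal T unc = unc , λ w j≢w e → case trans (sym (T w (j≢w ∘ sym))) e of λ ()

  #uncoloredIn-j-step : ∀ {s s' v c} → proj₁ v ≡ j → Legal s v c → Step s v c s' →
                       #uncoloredIn s j ≡ suc (#uncoloredIn s' j)
  #uncoloredIn-j-step refl = #uncoloredIn-step

  bobCanMove : ∀ {s} → Proper s → Untouched s → #used s ≤ 2 → HasMove s
  bobCanMove P T u≤2 = hasMove P (T (other , fromℕ< (pos other)) (punchInᵢ≢i j zero))
                                 (λ _ → ≤-trans (s≤s u≤2) (s≤s (s≤s (s≤s z≤n))))
    where other = punchIn j zero

  aliceWinsA-afterBobOutside : ∀ {s} → Proper s → #used s ≤ 3 → #fresh s ≤ 1 + K → AliceWinsA s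
  aliceWinsA-afterBobOutside P u f = aliceWinsA-bounded P u f (≤-reflexive (eq K))
    where eq : ∀ K → 3 + 2 * (1 + K) ≡ 5 + 2 * K
          eq = solve-∀

  aliceWinsA-afterBobInside : ∀ {s} → Proper s → #used s ≤ 1 → #fresh s ≤ 2 + K → AliceWinsA s
  aliceWinsA-afterBobInside P u f = aliceWinsA-bounded P u f (≤-reflexive (eq K))
    where eq : ∀ K → 1 + 2 * (2 + K) ≡ 5 + 2 * K
          eq = solve-∀

  v₀ : KVertex (3 + K) r
  v₀ = j , fromℕ< (pos j)

  c₀ : Fin (4 + 2 * K)
  c₀ = zero

  s₁ : Position
  s₁ = color empty v₀ c₀

  St₁ : Step empty v₀ c₀ s₁
  St₁ = color-step empty v₀ c₀

  L₁ : Legal empty v₀ c₀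
  L₁ = untouched-legal {a = proj₂ v₀} untouched-empty refl

  P₁ : Proper s₁
  P₁ = proper-step L₁ St₁ λ _ _ _ _ ()

  T₁ : Untouched s₁
  T₁ = untouched-step untouched-empty St₁ refl

  #used₁ : #used s₁ ≤ 1
  #used₁ = ≤-trans (#used-step L₁ St₁) (s≤s (≤-reflexive (count-none (used? empty) λ _ ())))

  #fresh₁ : #fresh s₁ ≤ 2 + K
  #fresh₁ = ≤-pred (≤-trans (#fresh-step-fresh L₁ St₁ λ _ → refl) (count≤n (fresh? empty)))

  #uncoloredIn₁ : #uncoloredIn s₁ j ≡ 2
  #uncoloredIn₁ = suc-injective (begin
    suc (#uncoloredIn s₁ j)   ≡⟨ sym (#uncoloredIn-step L₁ St₁) ⟩
    #uncoloredIn empty j      ≡⟨ count-all (λ a → uncolored? empty (j , a)) (λ _ → refl) ⟩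
    r j                       ≡⟨ rj≡3 ⟩
    3                         ∎)
    where open ≡-Reasoning

  completePart : ∀ {v c s₂} → proj₁ v ≡ j → Legal s₁ v c → Step s₁ v c s₂ → AliceWinsA s₂
  completePart {v} {c} {s₂} v∈j L St =
    moveA (j , a₂) c₀ s₃ L₂ St₂ (moveB (bobCanMove P₃ T₃ #used₃) bobReply)
    where
    T₂ = untouched-step T₁ St v∈j
    #uncoloredIn₂ : #uncoloredIn s₂ j ≡ 1
    #uncoloredIn₂ = suc-injective (trans (sym (#uncoloredIn-j-step v∈j L St)) #uncoloredIn₁)
    free = count>0⇒∃ _ (≤-reflexive (sym #uncoloredIn₂))
    a₂ = proj₁ free
    L₂ = untouched-legal T₂ (proj₂ free)
    s₃ = color s₂ (j , a₂) c₀
    St₂ = color-step s₂ (j , a₂) c₀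
    P₃ = proper-step L₂ St₂ (proper-step L St P₁)
    T₃ = untouched-step T₂ St₂ refl
    #uncoloredIn₃ : #uncoloredIn s₃ j ≡ 0
    #uncoloredIn₃ = suc-injective (trans (sym (#uncoloredIn-step L₂ St₂)) #uncoloredIn₂)
    c₀-used : Used s₂ c₀
    c₀-used = v₀ , trans (proj₂ St v₀ (colored≢uncolored (proj₁ St₁) (proj₁ L))) (proj₁ St₁)
    #used₃ : #used s₃ ≤ 2
    #used₃ = ≤-trans (#used-step-reused L₂ St₂ c₀-used) (≤-trans (#used-step L St) (s≤s #used₁))
    #fresh₃ : #fresh s₃ ≤ 2 + K
    #fresh₃ = ≤-trans (#fresh-step L₂ St₂) (≤-trans (#fresh-step L St) #fresh₁)
    j-full : ∀ w → proj₁ w ≡ j → ¬ Uncolored s₃ w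
    j-full (_ , b) refl unc =
      case subst (0 <_) #uncoloredIn₃ (∃⇒count>0 (λ b → uncolored? s₃ (j , b)) unc) of λ ()
    bobReply : ∀ v c s₄ → Legal s₃ v c → Step s₃ v c s₄ → AliceWinsA s₄
    bobReply (i , a') c' s₄ L' St' = reply (i ≟ j)
      where
      reply : Dec (i ≡ j) → AliceWinsA s₄
      reply (yes i≡j) = ⊥-elim (j-full (i , a') i≡j (proj₁ L'))
      reply (no i≢j)  = aliceWinsA-afterBobOutside (proper-step L' St' P₃)
                          (≤-trans (#used-step L' St') (s≤s #used₃))
                          (≤-pred (≤-trans (#fresh-step-fresh L' St' (untouched-fresh T₃ i≢j)) #fresh₃))

  bobReply : ∀ v c s₂ → Legal s₁ v c → Step s₁ v c s₂ → AliceWinsA s₂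
  bobReply v c s₂ L St = reply (proj₁ v ≟ j) (c ≟ c₀)
    where
    reply : Dec (proj₁ v ≡ j) → Dec (c ≡ c₀) → AliceWinsA s₂
    reply (no v∉j) _ =
      aliceWinsA-afterBobOutside (proper-step L St P₁)
        (≤-trans (#used-step L St) (s≤s (≤-trans #used₁ (n≤1+n 1))))
        (≤-pred (≤-trans (#fresh-step-fresh L St (untouched-fresh T₁ v∉j)) #fresh₁))
    reply (yes _) (yes c≡c₀) =
      aliceWinsA-afterBobInside (proper-step L St P₁)
        (≤-trans (#used-step-reused L St (v₀ , trans (proj₁ St₁) (cong just (sym c≡c₀)))) #used₁)
        (≤-trans (#fresh-step L St) #fresh₁)
    reply (yes v∈j) (no _) = completePart v∈j L St

  aliceWins : AliceWins
  aliceWins =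
    moveA v₀ c₀ s₁ L₁ St₁ (moveB (bobCanMove P₁ T₁ (≤-trans #used₁ (n≤1+n 1))) bobReply)

corollary2 : (k : ℕ) (r : Fin k → ℕ) → ValidParts k r → k ≥ 3 →
    (∃[ j ] (r j ≡ 3)) →
    GameChromatic≤ (KVertex k r) (KAdj k r) (2 * k ∸ 2)
corollary2 (suc (suc (suc K))) r (pos , _) (s≤s (s≤s (s≤s _))) (j , rj≡3) =
  4 + 2 * K , ≤-reflexive (sym colors) , Opening.aliceWins K r pos j rj≡3
  where
  colors : 2 * (3 + K) ∸ 2 ≡ 4 + 2 * K
  colors = cong (_∸ 2) (eq K)
    where eq : ∀ K → 2 * (3 + K) ≡ 2 + (4 + 2 * K)
          eq = solve-∀
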